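{- Let $G=(V,E)$ be an instance of the MST problem under uncertainty whose lower limit tree $T_L$ and upper limit tree $T_U$ are unique and satisfy $T_L=T_U$. Let $f_1,\ldots,f_l$ be the edges of $E\setminus T_L$ ordered by non-decreasing lower limit, and for $i\in\{1,\dots,l\}$ let $C_i$ be the unique cycle in $T_L\cup\{f_i\}$. Then $G$ is prediction mandatory free if and only if $\bar w_{f_i} \ge U_{e}$ and $\bar w_e \le L_{f_i}$ hold for every $i \in \{1,\ldots,l\}$ and every $e \in C_i \setminus \{f_i\}$.
   Context: MST problem under uncertainty: graph $G=(V,E)$, each edge $e$ has an interval $I_e$ that is open $(L_e,U_e)$ or trivial (for trivial $I_e=\{w_e\}$, $L_e=U_e=w_e$), an unknown true weight $w_e\in I_e$ (revealed by a query) and a predicted weight $\bar w_e\in I_e$; the task is to find a spanning tree that is an MST for the true weights. A query set $Q$ is feasible if some spanning tree is an MST for every weight assignment in the intervals agreeing with the true weights on $Q$. An edge is prediction mandatory if it belongs to every feasible query set when the true weights are assumed to equal the predicted weights; an instance is prediction mandatory free if it has no prediction mandatory edge. The lower limit tree $T_L$ is an MST for weights $L_e+\epsilon$ and the upper limit tree $T_U$ an MST for weights $U_e-\epsilon$, for an infinitesimally small $\epsilon>0$.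
   Formalization: The interval limits $L_e$ and $U_e$, the predicted weights, the weight assignments tested in the definition of feasibility, and the infinitesimal $\epsilon$ all take values in ℚ. -}

module Defs where

open import Data.Nat using (ℕ; zero; suc)
open import Data.Fin using (Fin; zero; suc)
open import Data.Fin.Subset using (Subset; _∈_; _∉_; _∪_; ⁅_⁆)
open import Data.Vec using (lookup)
open import Data.Bool using (Bool; true; false; if_then_else_)
open import Data.Rational using (ℚ; 0ℚ; _+_; _-_; _<_; _≤_)
open import Data.Product using (Σ; _×_; _,_; proj₁; proj₂; ∃-syntax)
open import Data.Sum using (_⊎_)
open import Data.List using (List; []; _∷_)
open import Data.List.Relation.Unary.Unique.Propositional using (Unique)
import Data.List.Membership.Propositional as LM
open import Data.Empty using (⊥)
open import Relation.Nullary using (¬_)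
open import Relation.Binary.PropositionalEquality using (_≡_; _≢_)
open import Function using (_⇔_)

-- Each edge has an interval given by L e, U e and a
-- flag 'trivial e': trivial intervals are {L e} with L e = U e, the others
-- are the open intervals (L e , U e) with L e < U e.  wpred is the predicted
-- weight, lying in the interval.  (The hidden true weights play no role in
-- the statement, which only concerns predictions.)

record Instance : Set where
  field
    n m      : ℕ
    ends     : Fin m → Fin n × Fin n
    L U      : Fin m → ℚ
    trivial  : Fin m → Bool
    wpred    : Fin m → ℚ
    trivial-LU : ∀ e → trivial e ≡ true → L e ≡ U e
    open-LU    : ∀ e → trivial e ≡ false → L e < U e
    wpred-in   : ∀ e → (trivial e ≡ true × wpred e ≡ L e)
                     ⊎ (trivial e ≡ false × L e < wpred e × wpred e < U e)

module _ (I : Instance) where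
  open Instance I

  InInterval : Fin m → ℚ → Set
  InInterval e x = (trivial e ≡ true × x ≡ L e)
                 ⊎ (trivial e ≡ false × L e < x × x < U e)

  Joins : Fin m → Fin n → Fin n → Set
  Joins e u v = (ends e ≡ (u , v)) ⊎ (ends e ≡ (v , u))

  data Walk (S : Subset m) : Fin n → Fin n → Set where
    []   : ∀ {v} → Walk S v v
    step : ∀ {u w v} (e : Fin m) → e ∈ S → Joins e u w → Walk S w v → Walk S u v

  walkEdges : ∀ {S u v} → Walk S u v → List (Fin m)
  walkEdges []               = []
  walkEdges (step e _ _ p)   = e ∷ walkEdges p

  walkVerts : ∀ {S u v} → Walk S u v → List (Fin n)
  walkVerts []                     = []
  walkVerts {u = u} (step e _ _ p) = u ∷ walkVerts p

  IsCycle : ∀ {S u} → Walk S u u → Set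
  IsCycle c = (walkEdges c ≢ []) × Unique (walkEdges c) × Unique (walkVerts c)

  Connected : Subset m → Set
  Connected S = ∀ u v → Walk S u v

  Acyclic : Subset m → Set
  Acyclic S = ∀ u (c : Walk S u u) → ¬ IsCycle c

  IsSpanningTree : Subset m → Set
  IsSpanningTree S = Connected S × Acyclic S

  sumFin : (k : ℕ) → (Fin k → ℚ) → ℚ
  sumFin zero    f = 0ℚ
  sumFin (suc k) f = f zero + sumFin k (λ i → f (suc i))

  weight : (Fin m → ℚ) → Subset m → ℚ
  weight w S = sumFin m (λ e → if lookup S e then w e else 0ℚ)

  IsMST : (Fin m → ℚ) → Subset m → Set
  IsMST w T = IsSpanningTree T × (∀ T' → IsSpanningTree T' → weight w T ≤ weight w T')

  Feasible : (Fin m → ℚ) → Subset m → Set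
  Feasible w Q = ∃[ T ] (∀ (w' : Fin m → ℚ) → (∀ e → InInterval e (w' e))
                         → (∀ e → e ∈ Q → w' e ≡ w e) → IsMST w' T)

  PredictionMandatory : Fin m → Set
  PredictionMandatory e = ∀ Q → Feasible wpred Q → e ∈ Q

  PredictionMandatoryFree : Set
  PredictionMandatoryFree = ∀ e → ¬ PredictionMandatory e

  lowerW : ℚ → Fin m → ℚ
  lowerW ε e = if trivial e then L e else L e + ε

  upperW : ℚ → Fin m → ℚ
  upperW ε e = if trivial e then U e else U e - ε

  UniqueInfinitesimalMST : (ℚ → Fin m → ℚ) → Subset m → Set
  UniqueInfinitesimalMST wε T =
    ∃[ ε₀ ] (0ℚ < ε₀ × (∀ ε → 0ℚ < ε → ε < ε₀ →
      IsMST (wε ε) T × (∀ T' → IsMST (wε ε) T' → T' ≡ T)))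

  UniqueLowerLimitTree : Subset m → Set
  UniqueLowerLimitTree = UniqueInfinitesimalMST lowerW

  UniqueUpperLimitTree : Subset m → Set
  UniqueUpperLimitTree = UniqueInfinitesimalMST upperW

  CycleCondition : Subset m → Set
  CycleCondition T =
    ∀ f → f ∉ T → ∀ u (c : Walk (T ∪ ⁅ f ⁆) u u) → IsCycle c →
      ∀ e → e LM.∈ walkEdges c → e ≢ f → (U e ≤ wpred f) × (wpred e ≤ L f)

{-# OPTIONS --safe #-}
-- If T is the unique lower and upper limit tree, then for every tree edge g
-- and every non-tree edge k crossing the fundamental cut of g in T we have
-- L g ≤ L k and U g ≤ U k, strictly when g (resp. k) is open.
--
-- If the cycle condition holds, T satisfies the cut optimality condition for
-- every weight vector that agrees with the predictions outside a single edge
-- e₀, so querying all edges but e₀ is feasible and no edge is prediction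
-- mandatory.
--
-- Conversely, by the duality of fundamental cycles and cuts, a violation of
-- the cycle condition is such a pair g, k with wpred k < U g or L k < wpred g,
-- and the inequalities above force g, resp. k, to be open.  If a feasible query
-- set, certified by a tree T*, omits that edge j, then T* stays minimum while
-- the weight of j sweeps its open interval, so every edge h exchangeable with j
-- satisfies U j ≤ wpred h (j ∈ T*) or wpred h ≤ L j (j ∉ T*).  With the
-- exchange property of spanning trees this yields a contradiction or a new
-- violation with strictly larger upper (resp. smaller lower) limit, and since
-- there are finitely many edges the descent ends: j is prediction mandatory.
module Submission where

open import Defs
open import Data.Fin.Subset using (Subset)
open import Function using (_⇔_)

open import Data.Bool using (true; false; if_then_else_)
open import Data.Empty using (⊥; ⊥-elim)
open import Data.Fin using (Fin; zero; suc; _≟_)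
open import Data.Fin.Induction using (spo-wellFounded; spo-noetherian)
open import Data.Fin.Properties using (any?; suc-injective)
open import Data.Fin.Subset using (_∈_; _∉_; _⊆_; _⊂_; _∪_; _─_; ⁅_⁆; ⊤; ∣_∣; outside)
open import Data.Fin.Subset.Properties
  using (_∈?_; ∈⊤; x∈⁅x⁆; x∈⁅y⁆⇒x≡y; x∈p∪q⁺; x∈p∪q⁻; p⊆p∪q; p─q⊆p; x∈p∧x∉q⇒x∈p─q; x∈p∧x≢y⇒x∈p-y;
         ⊆-antisym; p⊂q⇒∣p∣<∣q∣)
open import Data.List using (List; []; _∷_)
open import Data.List.Membership.Propositional using () renaming (_∈_ to _∈ᴸ_)
open import Data.List.Relation.Unary.All.Properties using (¬Any⇒All¬; All¬⇒¬Any)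
open import Data.List.Relation.Unary.All using ([]; _∷_)
open import Data.List.Relation.Unary.AllPairs using ([]; _∷_)
open import Data.List.Relation.Unary.Any using (here; there)
import Data.List.Relation.Unary.Any as Any
open import Data.List.Relation.Unary.Unique.Propositional using (Unique)
import Data.Nat as ℕ
open import Data.Nat using (zero; suc)
open import Data.Nat.Induction using (<-wellFounded)
open import Data.Product using (Σ-syntax; ∃-syntax; _×_; _,_; proj₁; proj₂; swap)
open import Data.Product.Properties using (,-injective)
open import Data.Rational using (ℚ; 0ℚ; _+_; _-_; -_; _<_; _≤_; _≤?_)
import Data.Rational.Properties as ℚ
open import Data.Rational.Solver using (module +-*-Solver)
open import Data.Sum using (_⊎_; inj₁; inj₂)
import Data.Sum as Sum
open import Data.Vec using (lookup)
import Data.Vec.Base as Vec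
open import Data.Vec.Properties using ([]=⇒lookup; lookup⇒[]=)
open import Data.Vec.Functional using (updateAt)
open import Data.Vec.Functional.Properties using (updateAt-updates; updateAt-minimal)
open import Effect.Monad using (RawMonad)
open import Function using (mk⇔; _∘_; _on_; flip; const)
open import Induction.WellFounded using (WellFounded; Acc; acc)
open import Level using (0ℓ)
import Relation.Binary.Construct.On as On
open import Relation.Binary.Definitions using (tri<; tri≈; tri>)
open import Relation.Binary.PropositionalEquality
  using (_≡_; _≢_; refl; sym; trans; cong; cong₂; subst; subst₂; module ≡-Reasoning)
open import Relation.Nullary using (¬_; Dec; yes; no; ¬?; contradiction)
open import Relation.Nullary.Decidable using (_×-dec_; decidable-stable; ¬¬-excluded-middle)
open import Relation.Nullary.Negation using (¬¬-Monad; ¬¬-map)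

open RawMonad (¬¬-Monad {a = 0ℓ}) using (_>>=_; pure)
open +-*-Solver using (solve; _:+_; _:-_; _:=_)

p+q-q≡p : ∀ p q → p + q - q ≡ p
p+q-q≡p = solve 2 (λ p q → p :+ q :- q := p) refl

p-q+q≡p : ∀ p q → p - q + q ≡ p
p-q+q≡p = solve 2 (λ p q → p :- q :+ q := p) refl

p+[q-p]≡q : ∀ p q → p + (q - p) ≡ q
p+[q-p]≡q = solve 2 (λ p q → p :+ (q :- p) := q) refl

+-cancelʳ-< : ∀ {p q} r → p + r < q + r → p < q
+-cancelʳ-< {p} {q} r p+r<q+r = subst₂ _<_ (p+q-q≡p p r) (p+q-q≡p q r) (ℚ.+-monoˡ-< (- r) p+r<q+r)

+-cancelʳ-≤ : ∀ {p q} r → p + r ≤ q + r → p ≤ q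
+-cancelʳ-≤ {p} {q} r p+r≤q+r = subst₂ _≤_ (p+q-q≡p p r) (p+q-q≡p q r) (ℚ.+-monoˡ-≤ (- r) p+r≤q+r)

p≤p+q : ∀ {p q} → 0ℚ ≤ q → p ≤ p + q
p≤p+q {p} 0≤q = subst (_≤ p + _) (ℚ.+-identityʳ p) (ℚ.+-monoʳ-≤ p 0≤q)

p<q⇒0<q-p : ∀ {p q} → p < q → 0ℚ < q - p
p<q⇒0<q-p {p} {q} p<q = subst (_< q - p) (ℚ.+-inverseʳ p) (ℚ.+-monoˡ-< (- p) p<q)

<-dense-below : ∀ {a b c} → a < b → a < c → ∃[ x ] a < x × x < b × x < c
<-dense-below a<b a<c with ℚ.≤-total _ _ | ℚ.<-dense a<b | ℚ.<-dense a<c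
... | inj₁ b≤c | x , a<x , x<b | _ = x , a<x , x<b , ℚ.<-≤-trans x<b b≤c
... | inj₂ c≤b | _ | x , a<x , x<c = x , a<x , ℚ.<-≤-trans x<c c≤b , x<c

<-dense-above : ∀ {a b c} → a < c → b < c → ∃[ x ] a < x × b < x × x < c
<-dense-above a<c b<c with ℚ.≤-total _ _ | ℚ.<-dense a<c | ℚ.<-dense b<c
... | inj₁ a≤b | _ | x , b<x , x<c = x , ℚ.≤-<-trans a≤b b<x , b<x , x<c
... | inj₂ b≤a | x , a<x , x<c | _ = x , a<x , ℚ.≤-<-trans b≤a a<x , x<c

≤-left-end : ∀ {a b c} → a < b → (∀ x → a < x → x < b → c ≤ x) → c ≤ a
≤-left-end a<b bound = ℚ.≮⇒≥ λ a<c →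
  let (x , a<x , x<b , x<c) = <-dense-below a<b a<c
  in ℚ.<-irrefl refl (ℚ.≤-<-trans (bound x a<x x<b) x<c)

≥-right-end : ∀ {a b c} → a < b → (∀ x → a < x → x < b → x ≤ c) → b ≤ c
≥-right-end a<b bound = ℚ.≮⇒≥ λ c<b →
  let (x , a<x , c<x , x<b) = <-dense-above a<b c<b
  in ℚ.<-irrefl refl (ℚ.<-≤-trans c<x (bound x a<x x<b))

≤-from-<+ε : ∀ {p q ε₀} → 0ℚ < ε₀ → (∀ ε → 0ℚ < ε → ε < ε₀ → p < q + ε) → p ≤ q
≤-from-<+ε {p} {q} 0<ε₀ p<q+ε = ℚ.≮⇒≥ λ q<p →
  let (ε , 0<ε , ε<ε₀ , ε<p-q) = <-dense-below 0<ε₀ (p<q⇒0<q-p q<p)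
  in ℚ.<-asym (p<q+ε ε 0<ε ε<ε₀) (subst (q + ε <_) (p+[q-p]≡q q p) (ℚ.+-monoʳ-< q ε<p-q))

x∈q⇒x∉p─q : ∀ {n} {x : Fin n} {p q : Subset n} → x ∈ q → x ∉ p ─ q
x∈q⇒x∉p─q {p = _ Vec.∷ _} Vec.here ()
x∈q⇒x∉p─q {p = _ Vec.∷ _} (Vec.there x∈q) (Vec.there x∈p─q) = x∈q⇒x∉p─q x∈q x∈p─q

x∈p∪⁅y⁆∧x≢y⇒x∈p : ∀ {n} {x y : Fin n} {p : Subset n} → x ∈ p ∪ ⁅ y ⁆ → x ≢ y → x ∈ p
x∈p∪⁅y⁆∧x≢y⇒x∈p {y = y} {p} x∈p∪⁅y⁆ x≢y with x∈p∪q⁻ p ⁅ y ⁆ x∈p∪⁅y⁆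
... | inj₁ x∈p   = x∈p
... | inj₂ x∈⁅y⁆ = contradiction (x∈⁅y⁆⇒x≡y y x∈⁅y⁆) x≢y

x∉p⇒lookup≡outside : ∀ {n} {x : Fin n} {p : Subset n} → x ∉ p → lookup p x ≡ outside
x∉p⇒lookup≡outside {x = x} {p} x∉p with lookup p x in eq
... | true  = contradiction (lookup⇒[]= x p eq) x∉p
... | false = refl

lookup-≡ : ∀ {n} {p q : Subset n} x → (x ∈ p → x ∈ q) → (x ∈ q → x ∈ p) → lookup p x ≡ lookup q x
lookup-≡ {p = p} x p⇒q q⇒p with x ∈? p
... | yes x∈p = trans ([]=⇒lookup x∈p) (sym ([]=⇒lookup (p⇒q x∈p)))
... | no x∉p  = trans (x∉p⇒lookup≡outside x∉p) (sym (x∉p⇒lookup≡outside (x∉p ∘ q⇒p)))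

exchange : ∀ {n} → Subset n → Fin n → Fin n → Subset n
exchange p x y = (p ─ ⁅ x ⁆) ∪ ⁅ y ⁆

x∈p∪⁅x⁆ : ∀ {n} {p : Subset n} x → x ∈ p ∪ ⁅ x ⁆
x∈p∪⁅x⁆ x = x∈p∪q⁺ (inj₂ (x∈⁅x⁆ x))

exchange-self : ∀ {n} {p : Subset n} {x} → x ∈ p → exchange p x x ≡ p
exchange-self {p = p} {x} x∈p = ⊆-antisym ⊆p p⊆
  where
  ⊆p : exchange p x x ⊆ p
  ⊆p z∈ with x∈p∪q⁻ (p ─ ⁅ x ⁆) ⁅ x ⁆ z∈
  ... | inj₁ z∈p-x = p─q⊆p p ⁅ x ⁆ z∈p-x
  ... | inj₂ z∈⁅x⁆ = subst (_∈ p) (sym (x∈⁅y⁆⇒x≡y x z∈⁅x⁆)) x∈p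
  p⊆ : p ⊆ exchange p x x
  p⊆ {z} z∈p with z ≟ x
  ... | yes refl = x∈p∪⁅x⁆ x
  ... | no z≢x   = p⊆p∪q ⁅ x ⁆ (x∈p∧x≢y⇒x∈p-y z∈p z≢x)

exchange-─-⊂ : ∀ {n} {p q : Subset n} {x y} → x ∈ q → y ∈ p → y ∉ q → exchange p y x ─ q ⊂ p ─ q
exchange-─-⊂ {p = p} {q} {x} {y} x∈q y∈p y∉q = ⊆ , y , x∈p∧x∉q⇒x∈p─q y∈p y∉q , y∉
  where
  ∉q : ∀ {z} → z ∈ exchange p y x ─ q → z ∉ q
  ∉q z∈ z∈q = x∈q⇒x∉p─q z∈q z∈
  ⊆ : exchange p y x ─ q ⊆ p ─ q
  ⊆ z∈ = x∈p∧x∉q⇒x∈p─q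
    (p─q⊆p p ⁅ y ⁆ (x∈p∪⁅y⁆∧x≢y⇒x∈p (p─q⊆p _ q z∈) λ { refl → ∉q z∈ x∈q })) (∉q z∈)
  y∉ : y ∉ exchange p y x ─ q
  y∉ y∈ = x∈q⇒x∉p─q (x∈⁅x⁆ y) (x∈p∪⁅y⁆∧x≢y⇒x∈p (p─q⊆p _ q y∈) λ { refl → y∉q x∈q })

module _ (I : Instance) where
  open Instance I
  open import Data.List.Membership.DecPropositional (_≟_ {m}) using () renaming (_∈?_ to _∈ᴸ?_)

  private
    variable
      S S′ T T* Q : Subset m
      e g h j k : Fin m
      u v x y x′ y′ : Fin n
      a ε : ℚ

  infix 4 _∈ʷ_ _∉ʷ_
  infixr 5 _++ʷ_

  _∈ʷ_ : Fin m → Walk I S u v → Set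
  e ∈ʷ p = e ∈ᴸ walkEdges I p

  _∉ʷ_ : Fin m → Walk I S u v → Set
  e ∉ʷ p = ¬ e ∈ʷ p

  _++ʷ_ : Walk I S u v → Walk I S v x → Walk I S u x
  []             ++ʷ q = q
  step e i j p   ++ʷ q = step e i j (p ++ʷ q)

  ∈ʷ-++⁻ : (p : Walk I S u v) {q : Walk I S v x} → e ∈ʷ p ++ʷ q → e ∈ʷ p ⊎ e ∈ʷ q
  ∈ʷ-++⁻ []             e∈q         = inj₂ e∈q
  ∈ʷ-++⁻ (step _ _ _ p) (here refl) = inj₁ (here refl)
  ∈ʷ-++⁻ (step _ _ _ p) (there e∈)  = Sum.map₁ there (∈ʷ-++⁻ p e∈)

  Joins-sym : Joins I e u v → Joins I e v u
  Joins-sym (inj₁ eq) = inj₂ eq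
  Joins-sym (inj₂ eq) = inj₁ eq

  Joins-unique : Joins I e u v → Joins I e x y → (x ≡ u × y ≡ v) ⊎ (x ≡ v × y ≡ u)
  Joins-unique (inj₁ p) (inj₁ q) = inj₁ (,-injective (trans (sym q) p))
  Joins-unique (inj₁ p) (inj₂ q) = inj₂ (swap (,-injective (trans (sym q) p)))
  Joins-unique (inj₂ p) (inj₁ q) = inj₂ (,-injective (trans (sym q) p))
  Joins-unique (inj₂ p) (inj₂ q) = inj₁ (swap (,-injective (trans (sym q) p)))

  reverse : Walk I S u v → Walk I S v u
  reverse []             = []
  reverse (step e i j p) = reverse p ++ʷ step e i (Joins-sym j) []

  ∈ʷ-reverse⁻ : (p : Walk I S u v) → e ∈ʷ reverse p → e ∈ʷ p
  ∈ʷ-reverse⁻ (step _ _ _ p) e∈ with ∈ʷ-++⁻ (reverse p) e∈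
  ... | inj₁ e∈p         = there (∈ʷ-reverse⁻ p e∈p)
  ... | inj₂ (here refl) = here refl

  reorient : Joins I e x y → Joins I e x′ y′ → Walk I S x′ y′ → Walk I S x y
  reorient j j′ p with Joins-unique j′ j
  ... | inj₁ (refl , refl) = p
  ... | inj₂ (refl , refl) = reverse p

  ∈ʷ-reorient⁻ : (j : Joins I e x y) (j′ : Joins I e x′ y′) (p : Walk I S x′ y′) →
                 h ∈ʷ reorient j j′ p → h ∈ʷ p
  ∈ʷ-reorient⁻ j j′ p h∈ with Joins-unique j′ j
  ... | inj₁ (refl , refl) = h∈
  ... | inj₂ (refl , refl) = ∈ʷ-reverse⁻ p h∈

  ∈ʷ⇒∈ : (p : Walk I S u v) → e ∈ʷ p → e ∈ S
  ∈ʷ⇒∈ (step _ e∈S _ _) (here refl) = e∈S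
  ∈ʷ⇒∈ (step _ _ _ p)   (there e∈p) = ∈ʷ⇒∈ p e∈p

  transfer : (p : Walk I S u v) → (∀ {e} → e ∈ʷ p → e ∈ S → e ∈ S′) → Walk I S′ u v
  transfer []             f = []
  transfer (step e i j p) f = step e (f (here refl) i) j (transfer p (λ e∈p → f (there e∈p)))

  transfer-edges : (p : Walk I S u v) (f : ∀ {e} → e ∈ʷ p → e ∈ S → e ∈ S′) →
                   walkEdges I (transfer p f) ≡ walkEdges I p
  transfer-edges []             f = refl
  transfer-edges (step e _ _ p) f = cong (e ∷_) (transfer-edges p _)

  transfer-verts : (p : Walk I S u v) (f : ∀ {e} → e ∈ʷ p → e ∈ S → e ∈ S′) →
                   walkVerts I (transfer p f) ≡ walkVerts I p
  transfer-verts []             f = refl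
  transfer-verts (step _ _ _ p) f = cong (_ ∷_) (transfer-verts p _)

  IsCycle-transfer : (c : Walk I S u u) (f : ∀ {e} → e ∈ʷ c → e ∈ S → e ∈ S′) →
                     IsCycle I c → IsCycle I (transfer c f)
  IsCycle-transfer c f isCycle rewrite transfer-edges c f | transfer-verts c f = isCycle

  weaken : S ⊆ S′ → Walk I S u v → Walk I S′ u v
  weaken S⊆S′ p = transfer p (λ _ → S⊆S′)

  avoiding : (p : Walk I S u v) → e ∉ʷ p → Walk I (S ─ ⁅ e ⁆) u v
  avoiding p e∉p = transfer p (λ h∈p h∈S → x∈p∧x≢y⇒x∈p-y h∈S λ { refl → e∉p h∈p })

  vertices : Walk I S u v → List (Fin n)
  vertices {v = v} []             = v ∷ []
  vertices {u = u} (step _ _ _ p) = u ∷ vertices p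

  IsPath : Walk I S u v → Set
  IsPath p = Unique (vertices p)

  start∈vertices : (p : Walk I S u v) → u ∈ᴸ vertices p
  start∈vertices []             = here refl
  start∈vertices (step _ _ _ _) = here refl

  end∈vertices : (p : Walk I S u v) → v ∈ᴸ vertices p
  end∈vertices []             = here refl
  end∈vertices (step _ _ _ p) = there (end∈vertices p)

  walkVerts⊆vertices : (p : Walk I S u v) → x ∈ᴸ walkVerts I p → x ∈ᴸ vertices p
  walkVerts⊆vertices (step _ _ _ p) (here refl) = here refl
  walkVerts⊆vertices (step _ _ _ p) (there x∈p) = there (walkVerts⊆vertices p x∈p)

  endpoint∈vertices : (p : Walk I S u v) → e ∈ʷ p → Joins I e x y → x ∈ᴸ vertices p
  endpoint∈vertices (step _ _ j p) (here refl) j′ with Joins-unique j j′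
  ... | inj₁ (refl , _) = here refl
  ... | inj₂ (refl , _) = there (start∈vertices p)
  endpoint∈vertices (step _ _ _ p) (there e∈p) j′ = there (endpoint∈vertices p e∈p j′)

  suffix : (p : Walk I S u v) → x ∈ᴸ vertices p → Σ[ q ∈ Walk I S x v ] (IsPath p → IsPath q)
  suffix []                 (here refl) = [] , λ p-path → p-path
  suffix p@(step _ _ _ _)   (here refl) = p , λ p-path → p-path
  suffix (step _ _ _ p)     (there x∈p) with suffix p x∈p
  ... | q , q-path = q , λ { (_ ∷ p-path) → q-path p-path }

  toPath : Walk I S u v → Σ[ q ∈ Walk I S u v ] IsPath q
  toPath []                       = [] , [] ∷ []
  toPath {u = u} (step e e∈S j p) with toPath p
  ... | q , q-path with Any.any? (u ≟_) (vertices q)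
  ...   | yes u∈q = let (r , r-path) = suffix q u∈q in r , r-path q-path
  ...   | no u∉q  = step e e∈S j q , ¬Any⇒All¬ _ u∉q ∷ q-path

  path-edges-unique : (p : Walk I S u v) → IsPath p → Unique (walkEdges I p)
  path-edges-unique []             _                = []
  path-edges-unique (step e _ j p) (u∉p ∷ p-path) =
    ¬Any⇒All¬ _ (λ e∈p → All¬⇒¬Any u∉p (endpoint∈vertices p e∈p j)) ∷ path-edges-unique p p-path

  path-closing-verts-unique : (p : Walk I S u v) → IsPath p → Unique (v ∷ walkVerts I p)
  path-closing-verts-unique []             _                = [] ∷ []
  path-closing-verts-unique (step _ _ _ p) (u∉p ∷ p-path) with path-closing-verts-unique p p-path
  ... | v∉p ∷ p-verts =
    ((λ v≡u → All¬⇒¬Any u∉p (subst (_∈ᴸ vertices p) v≡u (end∈vertices p))) ∷ v∉p)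
    ∷ ¬Any⇒All¬ _ (All¬⇒¬Any u∉p ∘ walkVerts⊆vertices p) ∷ p-verts

  closePath : e ∈ S → (j : Joins I e x y) (p : Walk I S′ y x) → IsPath p → e ∉ʷ p → S′ ⊆ S →
              Σ[ c ∈ Walk I S x x ] IsCycle I c × walkEdges I c ≡ e ∷ walkEdges I p
  closePath {e = e} {x = x} e∈S j p p-path e∉p S′⊆S =
    step e e∈S j p′ , ((λ ()) , edges-unique , verts-unique) , cong (e ∷_) (transfer-edges p _)
    where
    p′ = weaken S′⊆S p
    edges-unique : Unique (e ∷ walkEdges I p′)
    edges-unique rewrite transfer-edges p (λ _ → S′⊆S) = ¬Any⇒All¬ _ e∉p ∷ path-edges-unique p p-path
    verts-unique : Unique (x ∷ walkVerts I p′)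
    verts-unique rewrite transfer-verts p (λ _ → S′⊆S) = path-closing-verts-unique p p-path

  record Split (c : Walk I S u v) (e : Fin m) : Set where
    constructor split-at
    field
      {left right} : Fin n
      joins        : Joins I e left right
      before       : Walk I S u left
      after        : Walk I S right v
      e∉before     : e ∉ʷ before
      e∉after      : e ∉ʷ after
      pieces⊆      : ∀ {h} → h ∈ʷ before ⊎ h ∈ʷ after → h ∈ʷ c

  split : (c : Walk I S u v) → Unique (walkEdges I c) → e ∈ʷ c → Split c e
  split (step e _ j c) (e∉c ∷ _) (here refl) =
    split-at j [] c (λ ()) (All¬⇒¬Any e∉c) λ { (inj₂ h∈c) → there h∈c }
  split {e = e} (step e′ i j c) (e′∉c ∷ c-unique) (there e∈c) with split c c-unique e∈c
  ... | split-at j′ c₁ c₂ e∉c₁ e∉c₂ pieces⊆ = split-at j′ (step e′ i j c₁) c₂ e∉step e∉c₂ pieces⊆′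
    where
    e∉step : e ∉ʷ step e′ i j c₁
    e∉step (here refl) = All¬⇒¬Any e′∉c e∈c
    e∉step (there e∈c₁) = e∉c₁ e∈c₁
    pieces⊆′ : ∀ {h} → h ∈ʷ step e′ i j c₁ ⊎ h ∈ʷ c₂ → h ∈ʷ step e′ i j c
    pieces⊆′ (inj₁ (here refl))  = here refl
    pieces⊆′ (inj₁ (there h∈c₁)) = there (pieces⊆ (inj₁ h∈c₁))
    pieces⊆′ (inj₂ h∈c₂)         = there (pieces⊆ (inj₂ h∈c₂))

  detour : (c : Walk I S u u) → Unique (walkEdges I c) → e ∈ʷ c → Joins I e x y →
           Σ[ p ∈ Walk I S x y ] e ∉ʷ p × (∀ {h} → h ∈ʷ p → h ∈ʷ c)
  detour {e = e} c c-unique e∈c j with split c c-unique e∈c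
  ... | split-at j′ c₁ c₂ e∉c₁ e∉c₂ pieces⊆ = p , e∉p , λ h∈p → pieces⊆ (in-pieces h∈p)
    where
    p = reorient j (Joins-sym j′) (c₂ ++ʷ c₁)
    in-pieces : ∀ {h} → h ∈ʷ p → h ∈ʷ c₁ ⊎ h ∈ʷ c₂
    in-pieces h∈p = Sum.swap (∈ʷ-++⁻ c₂ (∈ʷ-reorient⁻ j (Joins-sym j′) (c₂ ++ʷ c₁) h∈p))
    e∉p : e ∉ʷ p
    e∉p e∈p = Sum.[ e∉c₁ , e∉c₂ ] (in-pieces e∈p)

  -- The fundamental cut of g in S separates the component of the first
  -- endpoint of g in S − g (the near side) from the rest.
  Near : Subset m → Fin m → Fin n → Set
  Near S g v = Walk I (S ─ ⁅ g ⁆) (proj₁ (ends g)) v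

  InCut : Subset m → Fin m → Fin m → Set
  InCut S g k = ∃[ x ] ∃[ y ] Joins I k x y × Near S g x × ¬ Near S g y

  far-endpoint : Acyclic I S → g ∈ S → ¬ Near S g (proj₂ (ends g))
  far-endpoint {S} {g} acyclic g∈S near with toPath near
  ... | p , p-path with closePath g∈S (inj₂ refl) p p-path (x∈q⇒x∉p─q (x∈⁅x⁆ g) ∘ ∈ʷ⇒∈ p) (p─q⊆p S ⁅ g ⁆)
  ... | c , isCycle , _ = acyclic _ c isCycle

  inCut-self : Acyclic I S → g ∈ S → InCut S g g
  inCut-self acyclic g∈S = _ , _ , inj₁ refl , [] , far-endpoint acyclic g∈S

  inCut⇒∉ : InCut S g k → k ≢ g → k ∉ S
  inCut⇒∉ (_ , _ , j , near-x , far-y) k≢g k∈S =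
    far-y (near-x ++ʷ step _ (x∈p∧x≢y⇒x∈p-y k∈S k≢g) j [])

  near-or-far : Connected I S → g ∈ S → ∀ v → Near S g v ⊎ Walk I (S ─ ⁅ g ⁆) (proj₂ (ends g)) v
  near-or-far {S} {g} connected g∈S v = propagate (connected (proj₁ (ends g)) v) (inj₁ [])
    where
    Side : Fin n → Set
    Side v = Near S g v ⊎ Walk I (S ─ ⁅ g ⁆) (proj₂ (ends g)) v
    propagate : Walk I S u v → Side u → Side v
    propagate []               side = side
    propagate (step e e∈S j p) side with e ≟ g
    ... | no e≢g = propagate p (Sum.map (_++ʷ edge) (_++ʷ edge) side)
      where edge = step e (x∈p∧x≢y⇒x∈p-y e∈S e≢g) j []
    ... | yes refl with Joins-unique (inj₁ refl) j
    ...   | inj₁ (_ , refl) = propagate p (inj₂ [])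
    ...   | inj₂ (_ , refl) = propagate p (inj₁ [])

  -- Reachability is not decided here, so crossing edges are only found under
  -- double negation; every conclusion drawn from them is ⊥ or a decidable
  -- inequality.
  walk-crosses-cut : (p : Walk I S′ x y) → Near S g x → ¬ Near S g y → ¬ ¬ (∃[ k ] k ∈ʷ p × InCut S g k)
  walk-crosses-cut []                 near far = λ _ → far near
  walk-crosses-cut {S = S} {g = g} (step {w = z} k _ j p) near-x far-y =
    ¬¬-excluded-middle {A = Near S g z} >>= λ where
      (yes near-z) → ¬¬-map (λ (h , h∈p , g|h) → h , there h∈p , g|h) (walk-crosses-cut p near-z far-y)
      (no far-z)   → pure (k , here refl , _ , _ , j , near-x , far-z)

  exchange-connected : Connected I S → g ∈ S → InCut S g k → Connected I (exchange S g k)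
  exchange-connected {S} {g} {k} connected g∈S (x , y , j , near-x , far-y) u v =
    reverse (from-g u) ++ʷ from-g v
    where
    lift : ∀ {a b} → Walk I (S ─ ⁅ g ⁆) a b → Walk I (exchange S g k) a b
    lift = weaken (p⊆p∪q ⁅ k ⁆)
    from-g : ∀ v → Walk I (exchange S g k) (proj₁ (ends g)) v
    from-g v with near-or-far connected g∈S v | near-or-far connected g∈S y
    ... | inj₁ near-v | _            = lift near-v
    ... | inj₂ _      | inj₁ near-y  = ⊥-elim (far-y near-y)
    ... | inj₂ far-v  | inj₂ y-far   =
      lift near-x ++ʷ step k (x∈p∪⁅x⁆ k) j (reverse (lift y-far) ++ʷ lift far-v)

  exchange-acyclic : Acyclic I S → InCut S g k → Acyclic I (exchange S g k)
  exchange-acyclic {S} {g} {k} acyclic (x , y , j , near-x , far-y) u c isCycle@(_ , c-unique , _)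
    with k ∈ᴸ? walkEdges I c
  ... | yes k∈c = let (p , k∉p , _) = detour c c-unique k∈c j in
    far-y (near-x ++ʷ transfer p λ h∈p h∈ → x∈p∪⁅y⁆∧x≢y⇒x∈p h∈ λ { refl → k∉p h∈p })
  ... | no k∉c = acyclic u (transfer c drop-k) (IsCycle-transfer c drop-k isCycle)
    where
    drop-k : ∀ {h} → h ∈ʷ c → h ∈ exchange S g k → h ∈ S
    drop-k h∈c h∈ = p─q⊆p S ⁅ g ⁆ (x∈p∪⁅y⁆∧x≢y⇒x∈p h∈ λ { refl → k∉c h∈c })

  exchange-isSpanningTree : IsSpanningTree I S → g ∈ S → InCut S g k → IsSpanningTree I (exchange S g k)
  exchange-isSpanningTree (connected , acyclic) g∈S g|k =
    exchange-connected connected g∈S g|k , exchange-acyclic acyclic g|k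

  fundamental-cycle : Connected I S → k ∉ S →
    ∃[ u ] Σ[ c ∈ Walk I (S ∪ ⁅ k ⁆) u u ] IsCycle I c × k ∈ʷ c × (∀ {g} → InCut S g k → g ∈ʷ c)
  fundamental-cycle {S} {k} connected k∉S with toPath (connected (proj₂ (ends k)) (proj₁ (ends k)))
  ... | p , p-path with closePath (x∈p∪⁅x⁆ k) (inj₁ refl) p p-path (k∉S ∘ ∈ʷ⇒∈ p) (p⊆p∪q ⁅ k ⁆)
  ... | c , isCycle , c-edges = _ , c , isCycle , k∈c , g∈c
    where
    k∈c : k ∈ʷ c
    k∈c rewrite c-edges = here refl
    g∈c : InCut S g k → g ∈ʷ c
    g∈c {g} (x , y , j , near-x , far-y) rewrite c-edges =
      there (decidable-stable (g ∈ᴸ? walkEdges I p) λ g∉p →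
        far-y (near-x ++ʷ reorient j (inj₂ refl) (avoiding p g∉p)))

  cycle-edge-inCut : Acyclic I S → k ∉ S → (c : Walk I (S ∪ ⁅ k ⁆) u u) → IsCycle I c →
                     e ∈ʷ c → e ≢ k → e ∈ S × ¬ ¬ InCut S e k
  cycle-edge-inCut {S} {k} {e = e} acyclic k∉S c (_ , c-unique , _) e∈c e≢k
    with detour c c-unique e∈c (inj₁ refl)
  ... | p , e∉p , _ = e∈S , ¬¬-map crossing-is-k (walk-crosses-cut p [] (far-endpoint acyclic e∈S))
    where
    e∈S = x∈p∪⁅y⁆∧x≢y⇒x∈p (∈ʷ⇒∈ c e∈c) e≢k
    crossing-is-k : ∃[ h ] h ∈ʷ p × InCut S e h → InCut S e k
    crossing-is-k (h , h∈p , e|h) with x∈p∪q⁻ S ⁅ k ⁆ (∈ʷ⇒∈ p h∈p)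
    ... | inj₁ h∈S = ⊥-elim (inCut⇒∉ e|h (λ { refl → e∉p h∈p }) h∈S)
    ... | inj₂ h∈k = subst (InCut S e) (x∈⁅y⁆⇒x≡y k h∈k) e|h

  exchange-partner : IsSpanningTree I T → k ∉ T → InCut S g k →
                     ¬ ¬ (∃[ h ] h ∈ T × InCut S g h × InCut T h k)
  exchange-partner (connected , acyclic) k∉T (x , y , j , near-x , far-y)
    with fundamental-cycle connected k∉T
  ... | _ , c , isCycle@(_ , c-unique , _) , k∈c , _ with detour c c-unique k∈c j
  ... | p , k∉p , p⊆c = do
    (h , h∈p , g|h) ← walk-crosses-cut p near-x far-y
    let (h∈T , ¬¬h|k) = cycle-edge-inCut acyclic k∉T c isCycle (p⊆c h∈p) λ { refl → k∉p h∈p }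
    h|k ← ¬¬h|k
    pure (h , h∈T , g|h , h|k)

  cut-switch : IsSpanningTree I T → Acyclic I T* → g ∈ T* → k ∉ T → InCut T g k →
               ¬ ¬ (InCut T* g k ⊎ ∃[ h ] h ∈ T × h ≢ g × InCut T h k × InCut T* g h)
  cut-switch {T} {T*} {g} {k} (connected , acyclic) acyclic* g∈T* k∉T g|k
    with fundamental-cycle connected k∉T
  ... | _ , c , isCycle@(_ , c-unique , _) , _ , through-cut with detour c c-unique (through-cut g|k) (inj₁ refl)
  ... | p , g∉p , p⊆c = do
    (h , h∈p , g|*h) ← walk-crosses-cut p [] (far-endpoint acyclic* g∈T*)
    classify h (h ≟ k) (λ { refl → g∉p h∈p }) (p⊆c h∈p) g|*h
    where
    classify : ∀ h → Dec (h ≡ k) → h ≢ g → h ∈ʷ c → InCut T* g h →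
             ¬ ¬ (InCut T* g k ⊎ ∃[ h ] h ∈ T × h ≢ g × InCut T h k × InCut T* g h)
    classify h (yes refl) _   _   g|*k = pure (inj₁ g|*k)
    classify h (no h≢k)   h≢g h∈c g|*h = do
      let (h∈T , ¬¬h|k) = cycle-edge-inCut acyclic k∉T c isCycle h∈c h≢k
      h|k ← ¬¬h|k
      pure (inj₂ (h , h∈T , h≢g , h|k , g|*h))

  sumFin-cong : ∀ k {F G : Fin k → ℚ} → (∀ e → F e ≡ G e) → sumFin I k F ≡ sumFin I k G
  sumFin-cong zero    F≗G = refl
  sumFin-cong (suc k) F≗G = cong₂ _+_ (F≗G zero) (sumFin-cong k (F≗G ∘ suc))

  sumFin-update : ∀ k (F G : Fin k → ℚ) i → (∀ e → e ≢ i → F e ≡ G e) →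
                  sumFin I k G + F i ≡ sumFin I k F + G i
  sumFin-update (suc k) F G zero agree = begin
    G zero + ΣG + F zero ≡⟨ cong (λ s → G zero + s + F zero) (sumFin-cong k λ e → sym (agree (suc e) λ ())) ⟩
    G zero + ΣF + F zero ≡⟨ solve 3 (λ a s b → a :+ s :+ b := b :+ s :+ a) refl (G zero) ΣF (F zero) ⟩
    F zero + ΣF + G zero ∎
    where
    open ≡-Reasoning
    ΣF = sumFin I k (F ∘ suc)
    ΣG = sumFin I k (G ∘ suc)
  sumFin-update (suc k) F G (suc i) agree = begin
    G zero + ΣG + F (suc i)     ≡⟨ ℚ.+-assoc (G zero) ΣG (F (suc i)) ⟩
    G zero + (ΣG + F (suc i))   ≡⟨ cong₂ _+_ (sym (agree zero λ ())) tail-update ⟩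
    F zero + (ΣF + G (suc i))   ≡⟨ ℚ.+-assoc (F zero) ΣF (G (suc i)) ⟨
    F zero + ΣF + G (suc i)     ∎
    where
    open ≡-Reasoning
    ΣF = sumFin I k (F ∘ suc)
    ΣG = sumFin I k (G ∘ suc)
    tail-update = sumFin-update k (F ∘ suc) (G ∘ suc) i λ e e≢i → agree (suc e) (e≢i ∘ suc-injective)

  indicator : (Fin m → ℚ) → Subset m → Fin m → ℚ
  indicator w S e = if lookup S e then w e else 0ℚ

  indicator-∈ : (w : Fin m → ℚ) → e ∈ S → indicator w S e ≡ w e
  indicator-∈ {e} w e∈S = cong (λ b → if b then w e else 0ℚ) ([]=⇒lookup e∈S)

  indicator-∉ : (w : Fin m → ℚ) → e ∉ S → indicator w S e ≡ 0ℚ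
  indicator-∉ {e} w e∉S = cong (λ b → if b then w e else 0ℚ) (x∉p⇒lookup≡outside e∉S)

  weight-∪⁅⁆ : (w : Fin m → ℚ) → j ∉ S → weight I w (S ∪ ⁅ j ⁆) ≡ weight I w S + w j
  weight-∪⁅⁆ {j} {S} w j∉S = begin
    weight I w S⁺                      ≡⟨ ℚ.+-identityʳ _ ⟨
    weight I w S⁺ + 0ℚ                 ≡⟨ cong (weight I w S⁺ +_) (indicator-∉ {S = S} w j∉S) ⟨
    weight I w S⁺ + indicator w S j    ≡⟨ sumFin-update m (indicator w S) (indicator w S⁺) j agree ⟩
    weight I w S + indicator w S⁺ j    ≡⟨ cong (weight I w S +_) (indicator-∈ {S = S⁺} w (x∈p∪⁅x⁆ j)) ⟩
    weight I w S + w j                 ∎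
    where
    open ≡-Reasoning
    S⁺ = S ∪ ⁅ j ⁆
    agree : ∀ e → e ≢ j → indicator w S e ≡ indicator w S⁺ e
    agree e e≢j = cong (λ b → if b then w e else 0ℚ)
      (lookup-≡ {p = S} {q = S⁺} e (p⊆p∪q ⁅ j ⁆) λ e∈S⁺ → x∈p∪⁅y⁆∧x≢y⇒x∈p e∈S⁺ e≢j)

  weight-exchange : (w : Fin m → ℚ) → g ∈ S → k ∉ S →
                    weight I w (exchange S g k) + w g ≡ weight I w S + w k
  weight-exchange {g} {S} {k} w g∈S k∉S = begin
    weight I w (S⁻ ∪ ⁅ k ⁆) + w g   ≡⟨ cong (_+ w g) (weight-∪⁅⁆ {S = S⁻} w (k∉S ∘ p─q⊆p S ⁅ g ⁆)) ⟩
    weight I w S⁻ + w k + w g        ≡⟨ solve 3 (λ a b c → a :+ b :+ c := a :+ c :+ b) refl (weight I w S⁻) (w k) (w g) ⟩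
    weight I w S⁻ + w g + w k        ≡⟨ cong (_+ w k) (weight-∪⁅⁆ {S = S⁻} w (x∈q⇒x∉p─q (x∈⁅x⁆ g))) ⟨
    weight I w (S⁻ ∪ ⁅ g ⁆) + w k   ≡⟨ cong (λ X → weight I w X + w k) (exchange-self g∈S) ⟩
    weight I w S + w k               ∎
    where
    open ≡-Reasoning
    S⁻ = S ─ ⁅ g ⁆

  CutOptimal : (Fin m → ℚ) → Subset m → Set
  CutOptimal w T = ∀ {g k} → g ∈ T → k ∉ T → InCut T g k → w g ≤ w k

  mst⇒cutOptimal : {w : Fin m → ℚ} → IsMST I w T → CutOptimal w T
  mst⇒cutOptimal {T = T} {w = w} (tree , minimal) {g} {k} g∈T k∉T g|k = ℚ.≮⇒≥ λ wk<wg → begin-contradiction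
    weight I w T′ + w g   ≡⟨ weight-exchange w g∈T k∉T ⟩
    weight I w T + w k    <⟨ ℚ.+-monoʳ-< (weight I w T) wk<wg ⟩
    weight I w T + w g    ≤⟨ ℚ.+-monoˡ-≤ (w g) (minimal T′ (exchange-isSpanningTree tree g∈T g|k)) ⟩
    weight I w T′ + w g   ∎
    where
    open ℚ.≤-Reasoning
    T′ = exchange T g k

  uniqueMst⇒cut-strict : {w : Fin m → ℚ} → IsMST I w T → (∀ T′ → IsMST I w T′ → T′ ≡ T) →
                         g ∈ T → k ∉ T → InCut T g k → w g < w k
  uniqueMst⇒cut-strict {T = T} {g = g} {k = k} {w = w} mst@(tree , minimal) unique g∈T k∉T g|k with ℚ.<-cmp (w g) (w k)
  ... | tri< wg<wk _ _ = wg<wk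
  ... | tri> _ _ wk<wg = ⊥-elim (ℚ.<-irrefl refl (ℚ.<-≤-trans wk<wg (mst⇒cutOptimal mst g∈T k∉T g|k)))
  ... | tri≈ _ wg≡wk _ = contradiction (subst (k ∈_) (unique T′ T′-mst) (x∈p∪⁅x⁆ k)) k∉T
    where
    open ℚ.≤-Reasoning
    T′ = exchange T g k
    T′-mst : IsMST I w T′
    T′-mst = exchange-isSpanningTree tree g∈T g|k , λ X X-tree → +-cancelʳ-≤ (w g) (begin
      weight I w T′ + w g   ≡⟨ weight-exchange w g∈T k∉T ⟩
      weight I w T + w k    ≡⟨ cong (weight I w T +_) wg≡wk ⟨
      weight I w T + w g    ≤⟨ ℚ.+-monoˡ-≤ (w g) (minimal X X-tree) ⟩
      weight I w X + w g    ∎)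

  spanningTree-maximal : IsSpanningTree I T → Acyclic I S → T ⊆ S → S ⊆ T
  spanningTree-maximal {T} (connected , _) acyclic T⊆S {e} e∈S = decidable-stable (e ∈? T) λ e∉T →
    far-endpoint acyclic e∈S (weaken (λ h∈T → x∈p∧x≢y⇒x∈p-y (T⊆S h∈T) λ { refl → e∉T h∈T }) (connected _ _))

  cutOptimal⇒mst : {w : Fin m → ℚ} → IsSpanningTree I T → CutOptimal w T → IsMST I w T
  cutOptimal⇒mst {T = T} {w = w} tree optimal = tree , λ X X-tree → lighter X (measure-wellFounded X) X-tree
    where
    _⊏_ : Subset m → Subset m → Set
    _⊏_ = ℕ._<_ on λ X → ∣ X ─ T ∣
    measure-wellFounded : WellFounded _⊏_
    measure-wellFounded = On.wellFounded (λ X → ∣ X ─ T ∣) <-wellFounded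
    lighter : ∀ X → Acc _⊏_ X → IsSpanningTree I X → weight I w T ≤ weight I w X
    lighter X (acc smaller) X-tree with any? (λ g → g ∈? T ×-dec ¬? (g ∈? X))
    ... | no T⊆X = ℚ.≤-reflexive (cong (weight I w) (⊆-antisym T⊆X′ (spanningTree-maximal tree (proj₂ X-tree) T⊆X′)))
      where
      T⊆X′ : T ⊆ X
      T⊆X′ {g} g∈T = decidable-stable (g ∈? X) λ g∉X → T⊆X (g , g∈T , g∉X)
    ... | yes (g , g∈T , g∉X) = decidable-stable (weight I w T ≤? weight I w X) do
      (h , h∈X , g|h , h|*g) ← exchange-partner X-tree g∉X (inCut-self (proj₂ tree) g∈T)
      let h∉T = inCut⇒∉ g|h λ { refl → g∉X h∈X }
          X′ = exchange X h g
          X′≤X : weight I w X′ ≤ weight I w X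
          X′≤X = +-cancelʳ-≤ (w h) (begin
            weight I w X′ + w h   ≡⟨ weight-exchange w h∈X g∉X ⟩
            weight I w X + w g    ≤⟨ ℚ.+-monoʳ-≤ (weight I w X) (optimal g∈T h∉T g|h) ⟩
            weight I w X + w h    ∎)
      pure (ℚ.≤-trans (lighter X′ (smaller (p⊂q⇒∣p∣<∣q∣ (exchange-─-⊂ g∈T h∈X h∉T)))
                                   (exchange-isSpanningTree X-tree h∈X h|*g)) X′≤X)
      where
      open ℚ.≤-Reasoning

  InInterval-L≤ : InInterval I e a → L e ≤ a
  InInterval-L≤ (inj₁ (_ , refl))    = ℚ.≤-refl
  InInterval-L≤ (inj₂ (_ , L<a , _)) = ℚ.<⇒≤ L<a

  InInterval-≤U : InInterval I e a → a ≤ U e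
  InInterval-≤U {e} (inj₁ (e-trivial , refl)) = ℚ.≤-reflexive (trivial-LU e e-trivial)
  InInterval-≤U     (inj₂ (_ , _ , a<U))       = ℚ.<⇒≤ a<U

  InInterval-open : trivial e ≡ false → InInterval I e a → L e < a × a < U e
  InInterval-open e-open (inj₁ (e-trivial , _)) = contradiction (trans (sym e-trivial) e-open) λ ()
  InInterval-open _      (inj₂ (_ , L<a , a<U)) = L<a , a<U

  L≤wpred : ∀ e → L e ≤ wpred e
  L≤wpred e = InInterval-L≤ (wpred-in e)

  wpred≤U : ∀ e → wpred e ≤ U e
  wpred≤U e = InInterval-≤U (wpred-in e)

  wpred-open : trivial e ≡ false → L e < wpred e × wpred e < U e
  wpred-open {e} e-open = InInterval-open e-open (wpred-in e)

  lowerW-open : trivial e ≡ false → lowerW I ε e ≡ L e + ε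
  lowerW-open {e} {ε} e-open = cong (λ b → if b then L e else L e + ε) e-open

  upperW-open : trivial e ≡ false → upperW I ε e ≡ U e - ε
  upperW-open {e} {ε} e-open = cong (λ b → if b then U e else U e - ε) e-open

  lowerW-bounds : 0ℚ ≤ ε → ∀ e → L e ≤ lowerW I ε e × lowerW I ε e ≤ L e + ε
  lowerW-bounds {ε} 0≤ε e = bounds (trivial e)
    where
    bounds : ∀ b → L e ≤ (if b then L e else L e + ε) × (if b then L e else L e + ε) ≤ L e + ε
    bounds true  = ℚ.≤-refl , p≤p+q 0≤ε
    bounds false = p≤p+q 0≤ε , ℚ.≤-refl

  upperW-bounds : 0ℚ ≤ ε → ∀ e → U e ≤ upperW I ε e + ε × upperW I ε e ≤ U e
  upperW-bounds {ε} 0≤ε e = bounds (trivial e)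
    where
    bounds : ∀ b → U e ≤ (if b then U e else U e - ε) + ε × (if b then U e else U e - ε) ≤ U e
    bounds true  = p≤p+q 0≤ε , ℚ.≤-refl
    bounds false = ℚ.≤-reflexive (sym (p-q+q≡p (U e) ε))
                 , subst (U e - ε ≤_) (p-q+q≡p (U e) ε) (p≤p+q 0≤ε)

  infinitesimal-isSpanningTree : {wε : ℚ → Fin m → ℚ} → UniqueInfinitesimalMST I wε T → IsSpanningTree I T
  infinitesimal-isSpanningTree (_ , 0<ε₀ , unique-mst) =
    let (ε , 0<ε , ε<ε₀) = ℚ.<-dense 0<ε₀ in proj₁ (proj₁ (unique-mst ε 0<ε ε<ε₀))

  infinitesimal-cut-strict : {wε : ℚ → Fin m → ℚ} → UniqueInfinitesimalMST I wε T →
                             g ∈ T → k ∉ T → InCut T g k →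
                             ∃[ ε₀ ] 0ℚ < ε₀ × (∀ ε → 0ℚ < ε → ε < ε₀ → wε ε g < wε ε k)
  infinitesimal-cut-strict (ε₀ , 0<ε₀ , unique-mst) g∈T k∉T g|k = ε₀ , 0<ε₀ , λ ε 0<ε ε<ε₀ →
    let (mst , unique) = unique-mst ε 0<ε ε<ε₀ in uniqueMst⇒cut-strict mst unique g∈T k∉T g|k

  module _ (lower : UniqueLowerLimitTree I T) (g∈T : g ∈ T) (k∉T : k ∉ T) (g|k : InCut T g k) where
    open ℚ.≤-Reasoning

    lowerLimit-≤ : L g ≤ L k
    lowerLimit-≤ with infinitesimal-cut-strict lower g∈T k∉T g|k
    ... | ε₀ , 0<ε₀ , lowerW< = ≤-from-<+ε 0<ε₀ λ ε 0<ε ε<ε₀ → begin-strict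
      L g            ≤⟨ proj₁ (lowerW-bounds (ℚ.<⇒≤ 0<ε) g) ⟩
      lowerW I ε g   <⟨ lowerW< ε 0<ε ε<ε₀ ⟩
      lowerW I ε k   ≤⟨ proj₂ (lowerW-bounds (ℚ.<⇒≤ 0<ε) k) ⟩
      L k + ε        ∎

    lowerLimit-< : trivial g ≡ false → L g < L k
    lowerLimit-< g-open with infinitesimal-cut-strict lower g∈T k∉T g|k
    ... | ε₀ , 0<ε₀ , lowerW< = let (ε , 0<ε , ε<ε₀) = ℚ.<-dense 0<ε₀ in +-cancelʳ-< ε (begin-strict
      L g + ε        ≡⟨ lowerW-open g-open ⟨
      lowerW I ε g   <⟨ lowerW< ε 0<ε ε<ε₀ ⟩
      lowerW I ε k   ≤⟨ proj₂ (lowerW-bounds (ℚ.<⇒≤ 0<ε) k) ⟩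
      L k + ε        ∎)

  module _ (upper : UniqueUpperLimitTree I T) (g∈T : g ∈ T) (k∉T : k ∉ T) (g|k : InCut T g k) where
    open ℚ.≤-Reasoning

    upperLimit-≤ : U g ≤ U k
    upperLimit-≤ with infinitesimal-cut-strict upper g∈T k∉T g|k
    ... | ε₀ , 0<ε₀ , upperW< = ≤-from-<+ε 0<ε₀ λ ε 0<ε ε<ε₀ → begin-strict
      U g                ≤⟨ proj₁ (upperW-bounds (ℚ.<⇒≤ 0<ε) g) ⟩
      upperW I ε g + ε   <⟨ ℚ.+-monoˡ-< ε (upperW< ε 0<ε ε<ε₀) ⟩
      upperW I ε k + ε   ≤⟨ ℚ.+-monoˡ-≤ ε (proj₂ (upperW-bounds (ℚ.<⇒≤ 0<ε) k)) ⟩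
      U k + ε            ∎

    upperLimit-< : trivial k ≡ false → U g < U k
    upperLimit-< k-open with infinitesimal-cut-strict upper g∈T k∉T g|k
    ... | ε₀ , 0<ε₀ , upperW< = let (ε , 0<ε , ε<ε₀) = ℚ.<-dense 0<ε₀ in begin-strict
      U g                ≤⟨ proj₁ (upperW-bounds (ℚ.<⇒≤ 0<ε) g) ⟩
      upperW I ε g + ε   <⟨ ℚ.+-monoˡ-< ε (upperW< ε 0<ε ε<ε₀) ⟩
      upperW I ε k + ε   ≡⟨ cong (_+ ε) (upperW-open k-open) ⟩
      U k - ε + ε        ≡⟨ p-q+q≡p (U k) ε ⟩
      U k                ∎

  -- Feasible I wpred Q unfolds to ∃[ T* ] Certifies Q T*.
  Certifies : Subset m → Subset m → Set
  Certifies Q T* = ∀ (w : Fin m → ℚ) → (∀ e → InInterval I e (w e)) → (∀ e → e ∈ Q → w e ≡ wpred e) →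
                   IsMST I w T*

  certifier-isSpanningTree : Certifies Q T* → IsSpanningTree I T*
  certifier-isSpanningTree certifies = proj₁ (certifies wpred wpred-in λ _ _ → refl)

  mandatory-intro : (∀ {Q T*} → Certifies Q T* → j ∉ Q → ⊥) → PredictionMandatory I j
  mandatory-intro {j} refute Q (T* , certifies) = decidable-stable (j ∈? Q) (refute certifies)

  module Unqueried {Q T* : Subset m} (certifies : Certifies Q T*) {j : Fin m} (j∉Q : j ∉ Q)
                   (j-open : trivial j ≡ false) where

    reweighted-mst : L j < a → a < U j → IsMST I (updateAt wpred j (const a)) T*
    reweighted-mst {a} L<a a<U = certifies (updateAt wpred j (const a)) in-interval agrees
      where
      in-interval : ∀ e → InInterval I e (updateAt wpred j (const a) e)
      in-interval e with e ≟ j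
      ... | yes refl = subst (InInterval I j) (sym (updateAt-updates j wpred)) (inj₂ (j-open , L<a , a<U))
      ... | no e≢j   = subst (InInterval I e) (sym (updateAt-minimal e j wpred e≢j)) (wpred-in e)
      agrees : ∀ e → e ∈ Q → updateAt wpred j (const a) e ≡ wpred e
      agrees e e∈Q = updateAt-minimal e j wpred λ { refl → j∉Q e∈Q }

    in-tree-bound : j ∈ T* → h ∉ T* → InCut T* j h → U j ≤ wpred h
    in-tree-bound {h} j∈T* h∉T* j|h = ≥-right-end (open-LU j j-open) λ a L<a a<U →
      subst₂ _≤_ (updateAt-updates j wpred) (updateAt-minimal h j wpred h≢j)
        (mst⇒cutOptimal (reweighted-mst L<a a<U) j∈T* h∉T* j|h)
      where
      h≢j : h ≢ j
      h≢j refl = h∉T* j∈T*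

    out-of-tree-bound : j ∉ T* → h ∈ T* → InCut T* h j → wpred h ≤ L j
    out-of-tree-bound {h} j∉T* h∈T* h|j = ≤-left-end (open-LU j j-open) λ a L<a a<U →
      subst₂ _≤_ (updateAt-minimal h j wpred h≢j) (updateAt-updates j wpred)
        (mst⇒cutOptimal (reweighted-mst L<a a<U) h∈T* j∉T* h|j)
      where
      h≢j : h ≢ j
      h≢j refl = j∉T* h∈T*

  module _ (lower : UniqueLowerLimitTree I T) (upper : UniqueUpperLimitTree I T) where
    open ℚ.≤-Reasoning

    private
      tree : IsSpanningTree I T
      tree = infinitesimal-isSpanningTree lower

    open-tree-edge⇒L<wpred : g ∈ T → k ∉ T → InCut T g k → trivial g ≡ false → L g < wpred k
    open-tree-edge⇒L<wpred g∈T k∉T g|k g-open =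
      ℚ.<-≤-trans (lowerLimit-< lower g∈T k∉T g|k g-open) (L≤wpred _)

    open-cut-edge⇒wpred<U : g ∈ T → k ∉ T → InCut T g k → trivial k ≡ false → wpred g < U k
    open-cut-edge⇒wpred<U g∈T k∉T g|k k-open =
      ℚ.≤-<-trans (wpred≤U _) (upperLimit-< upper g∈T k∉T g|k k-open)

    wpred<U⇒tree-edge-open : g ∈ T → k ∉ T → InCut T g k → wpred k < U g → trivial g ≡ false
    wpred<U⇒tree-edge-open {g} {k} g∈T k∉T g|k wk<Ug with trivial g in g-trivial
    ... | false = refl
    ... | true  = begin-contradiction
      wpred k   <⟨ wk<Ug ⟩
      U g       ≡⟨ trivial-LU g g-trivial ⟨
      L g       ≤⟨ lowerLimit-≤ lower g∈T k∉T g|k ⟩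
      L k       ≤⟨ L≤wpred k ⟩
      wpred k   ∎

    L<wpred⇒cut-edge-open : g ∈ T → k ∉ T → InCut T g k → L k < wpred g → trivial k ≡ false
    L<wpred⇒cut-edge-open {g} {k} g∈T k∉T g|k Lk<wg with trivial k in k-trivial
    ... | false = refl
    ... | true  = begin-contradiction
      wpred g   ≤⟨ wpred≤U g ⟩
      U g       ≤⟨ upperLimit-≤ upper g∈T k∉T g|k ⟩
      U k       ≡⟨ trivial-LU k k-trivial ⟨
      L k       <⟨ Lk<wg ⟩
      wpred g   ∎

    unqueried-open-nontree-edge-∉ : Certifies Q T* → k ∉ Q → trivial k ≡ false → k ∉ T → k ∉ T*
    unqueried-open-nontree-edge-∉ certifies k∉Q k-open k∉T k∈T* =
      exchange-partner tree k∉T (inCut-self (proj₂ (certifier-isSpanningTree certifies)) k∈T*)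
        λ (h , h∈T , k|*h , h|k) → begin-contradiction
          wpred h   <⟨ open-cut-edge⇒wpred<U h∈T k∉T h|k k-open ⟩
          U _       ≤⟨ in-tree-bound k∈T* (inCut⇒∉ k|*h λ { refl → k∉T h∈T }) k|*h ⟩
          wpred h   ∎
      where
      open Unqueried certifies k∉Q k-open

    unqueried-open-tree-edge-∈ : Certifies Q T* → g ∉ Q → trivial g ≡ false → g ∈ T → g ∈ T*
    unqueried-open-tree-edge-∈ {T* = T*} {g = g} certifies g∉Q g-open g∈T =
      decidable-stable (g ∈? T*) λ g∉T* →
        exchange-partner (certifier-isSpanningTree certifies) g∉T* (inCut-self (proj₂ tree) g∈T)
          λ (h , h∈T* , g|h , h|*g) → begin-contradiction
            L g       <⟨ open-tree-edge⇒L<wpred g∈T (inCut⇒∉ g|h λ { refl → g∉T* h∈T* }) g|h g-open ⟩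
            wpred h   ≤⟨ out-of-tree-bound g∉T* h∈T* h|*g ⟩
            L g       ∎
      where
      open Unqueried certifies g∉Q g-open

    lower-violation-descends : Certifies Q T* → k ∉ Q → k ∉ T → g ∈ T → InCut T g k → L k < wpred g →
                               ¬ ¬ (∃[ h ] h ∉ T × InCut T g h × L h < L k × L h < wpred g)
    lower-violation-descends certifies k∉Q k∉T g∈T g|k Lk<wg descend =
      exchange-partner (certifier-isSpanningTree certifies) k∉T* g|k λ (h , h∈T* , g|h , h|*k) →
        let wh≤Lk = out-of-tree-bound k∉T* h∈T* h|*k
            h∉T   = inCut⇒∉ g|h λ { refl → ℚ.<-irrefl refl (ℚ.≤-<-trans wh≤Lk Lk<wg) }
            Lh<wg = ℚ.≤-<-trans (ℚ.≤-trans (L≤wpred h) wh≤Lk) Lk<wg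
            Lh<Lk = ℚ.<-≤-trans (proj₁ (wpred-open (L<wpred⇒cut-edge-open g∈T h∉T g|h Lh<wg))) wh≤Lk
        in descend (h , h∉T , g|h , Lh<Lk , Lh<wg)
      where
      k-open = L<wpred⇒cut-edge-open g∈T k∉T g|k Lk<wg
      k∉T* = unqueried-open-nontree-edge-∉ certifies k∉Q k-open k∉T
      open Unqueried certifies k∉Q k-open

    upper-violation-ascends : Certifies Q T* → g ∉ Q → g ∈ T → k ∉ T → InCut T g k → wpred k < U g →
                              ¬ ¬ (∃[ h ] h ∈ T × InCut T h k × U g < U h × wpred k < U h)
    upper-violation-ascends {g = g} {k = k} certifies g∉Q g∈T k∉T g|k wk<Ug ascend =
      cut-switch tree (proj₂ (certifier-isSpanningTree certifies)) g∈T* k∉T g|k λ where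
        (inj₁ g|*k) → begin-contradiction
          wpred k   <⟨ wk<Ug ⟩
          U g       ≤⟨ in-tree-bound g∈T* (inCut⇒∉ g|*k λ { refl → k∉T g∈T }) g|*k ⟩
          wpred k   ∎
        (inj₂ (h , h∈T , h≢g , h|k , g|*h)) →
          let Ug≤wh  = in-tree-bound g∈T* (inCut⇒∉ g|*h h≢g) g|*h
              h-open = wpred<U⇒tree-edge-open h∈T k∉T h|k (ℚ.<-≤-trans wk<Ug (ℚ.≤-trans Ug≤wh (wpred≤U h)))
              Ug<Uh  = ℚ.≤-<-trans Ug≤wh (proj₂ (wpred-open h-open))
          in ascend (h , h∈T , h|k , Ug<Uh , ℚ.<-trans wk<Ug Ug<Uh)
      where
      g-open = wpred<U⇒tree-edge-open g∈T k∉T g|k wk<Ug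
      g∈T* = unqueried-open-tree-edge-∈ certifies g∉Q g-open g∈T
      open Unqueried certifies g∉Q g-open

    module _ (pmf : PredictionMandatoryFree I) where

      wpred≤L : Acc (_<_ on L) k → k ∉ T → g ∈ T → InCut T g k → wpred g ≤ L k
      wpred≤L {k} (acc smaller) k∉T g∈T g|k = ℚ.≮⇒≥ λ Lk<wg →
        pmf k (mandatory-intro λ certifies k∉Q →
          lower-violation-descends certifies k∉Q k∉T g∈T g|k Lk<wg λ (h , h∉T , g|h , Lh<Lk , Lh<wg) →
            ℚ.<-irrefl refl (ℚ.<-≤-trans Lh<wg (wpred≤L (smaller Lh<Lk) h∉T g∈T g|h)))

      U≤wpred : Acc (flip (_<_ on U)) g → g ∈ T → k ∉ T → InCut T g k → U g ≤ wpred k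
      U≤wpred {g} (acc larger) g∈T k∉T g|k = ℚ.≮⇒≥ λ wk<Ug →
        pmf g (mandatory-intro λ certifies g∉Q →
          upper-violation-ascends certifies g∉Q g∈T k∉T g|k wk<Ug λ (h , h∈T , h|k , Ug<Uh , wk<Uh) →
            ℚ.<-irrefl refl (ℚ.<-≤-trans wk<Uh (U≤wpred (larger Ug<Uh) h∈T k∉T h|k)))

    pmf⇒cycleCondition : PredictionMandatoryFree I → CycleCondition I T
    pmf⇒cycleCondition pmf f f∉T u c isCycle e e∈c e≢f with cycle-edge-inCut (proj₂ tree) f∉T c isCycle e∈c e≢f
    ... | e∈T , ¬¬e|f =
        decidable-stable (U e ≤? wpred f) (¬¬-map (U≤wpred pmf (U-noetherian e) e∈T f∉T) ¬¬e|f)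
      , decidable-stable (wpred e ≤? L f) (¬¬-map (wpred≤L pmf (L-wellFounded f) f∉T e∈T) ¬¬e|f)
      where
      L-wellFounded : WellFounded (_<_ on L)
      L-wellFounded = spo-wellFounded (On.isStrictPartialOrder L ℚ.<-isStrictPartialOrder)
      U-noetherian : WellFounded (flip (_<_ on U))
      U-noetherian = spo-noetherian (On.isStrictPartialOrder U ℚ.<-isStrictPartialOrder)

  cycleCondition⇒pmf : IsSpanningTree I T → CycleCondition I T → PredictionMandatoryFree I
  cycleCondition⇒pmf {T} tree cycleCondition e₀ mandatory =
    x∈q⇒x∉p─q (x∈⁅x⁆ e₀) (mandatory (⊤ ─ ⁅ e₀ ⁆) (T , certifies))
    where
    certifies : Certifies (⊤ ─ ⁅ e₀ ⁆) T
    certifies w in-interval agrees = cutOptimal⇒mst tree optimal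
      where
      open ℚ.≤-Reasoning
      agrees-off : ∀ {e} → e ≢ e₀ → w e ≡ wpred e
      agrees-off e≢e₀ = agrees _ (x∈p∧x≢y⇒x∈p-y ∈⊤ e≢e₀)
      optimal : CutOptimal w T
      optimal {g} {k} g∈T k∉T g|k with fundamental-cycle (proj₁ tree) k∉T
      ... | u , c , isCycle , _ , through-cut
        with cycleCondition k k∉T u c isCycle g (through-cut g|k) (λ { refl → k∉T g∈T })
      ... | Ug≤wk , wg≤Lk with g ≟ e₀ | k ≟ e₀
      ... | yes refl | _ = begin
        w g       ≤⟨ InInterval-≤U (in-interval g) ⟩
        U g       ≤⟨ Ug≤wk ⟩
        wpred k   ≡⟨ agrees-off (λ { refl → k∉T g∈T }) ⟨
        w k       ∎
      ... | no g≢e₀ | yes refl = begin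
        w g       ≡⟨ agrees-off g≢e₀ ⟩
        wpred g   ≤⟨ wg≤Lk ⟩
        L k       ≤⟨ InInterval-L≤ (in-interval k) ⟩
        w k       ∎
      ... | no g≢e₀ | no k≢e₀ = begin
        w g       ≡⟨ agrees-off g≢e₀ ⟩
        wpred g   ≤⟨ wg≤Lk ⟩
        L k       ≤⟨ L≤wpred k ⟩
        wpred k   ≡⟨ agrees-off k≢e₀ ⟨
        w k       ∎

lemma4 : (I : Instance) (T : Subset (Instance.m I)) →
         UniqueLowerLimitTree I T → UniqueUpperLimitTree I T →
         (PredictionMandatoryFree I ⇔ CycleCondition I T)
lemma4 I T lower upper =
  mk⇔ (pmf⇒cycleCondition I lower upper) (cycleCondition⇒pmf I (infinitesimal-isSpanningTree I lower))
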